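{- Let $l\geq 2$ be an integer and let $G$ be any properly edge-coloured graph on $n$ vertices. Then the number of non-rainbow copies of $C_{2l+1}$ in $G$ is at most $O(n^{2l-1})+O(R)$, where $R$ is the number of rainbow copies of $C_{2l+1}$ in $G$ and the implied constants depend only on $l$.
   Context: A proper edge-colouring assigns colours to edges so that edges sharing a vertex get different colours; a subgraph is rainbow if its edges have pairwise distinct colours. $C_m$ denotes the cycle of length $m$; a copy of $C_m$ is a subgraph isomorphic to it. -}

module Defs where

open import Data.Nat.Properties using (m*n≢0)
open import Data.Nat using (ℕ; zero; suc; _*_; _/_; _+_)
import Data.Nat as ℕ
open import Data.Fin using (Fin)
import Data.Fin as Fin
open import Data.Bool.ListAction using (and; any)
open import Data.Bool using (Bool; true; false; not; _∧_)
open import Data.List using (List; []; _∷_; [_]; _++_; map; concatMap; zip; filterᵇ; length; allFin)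
open import Data.List.Relation.Unary.All as All using ()
open import Data.Product using (_×_; _,_)
open import Relation.Binary.PropositionalEquality using (_≡_; _≢_)
open import Relation.Binary.Definitions using (DecidableEquality)
open import Relation.Nullary.Decidable using (⌊_⌋)

record Graph (n : ℕ) : Set where
  field
    adj    : Fin n → Fin n → Bool
    sym    : ∀ u v → adj u v ≡ adj v u
    irrefl : ∀ u → adj u u ≡ false
open Graph public

record ProperEdgeColouring {n : ℕ} (G : Graph n) : Set where
  field
    col    : Fin n → Fin n → ℕ
    colSym : ∀ u v → adj G u v ≡ true → col u v ≡ col v u
    proper : ∀ u v w → adj G u v ≡ true → adj G u w ≡ true → v ≢ w →
             col u v ≢ col u w
open ProperEdgeColouring public

allSeqs : (m n : ℕ) → List (List (Fin n))
allSeqs zero    n = [ [] ]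
allSeqs (suc m) n = concatMap (λ xs → map (_∷ xs) (allFin n)) (allSeqs m n)

distinct : {A : Set} → DecidableEquality A → List A → Bool
distinct _≟_ []       = true
distinct _≟_ (x ∷ xs) = not (any (λ y → ⌊ x ≟ y ⌋) xs) ∧ distinct _≟_ xs

rot : {A : Set} → List A → List A
rot []       = []
rot (x ∷ xs) = xs ++ [ x ]

cycEdges : {A : Set} → List A → List (A × A)
cycEdges xs = zip xs (rot xs)

isLabelledCycle : {n : ℕ} → Graph n → List (Fin n) → Bool
isLabelledCycle G xs =
  distinct Fin._≟_ xs ∧ and (map (λ { (u , v) → adj G u v }) (cycEdges xs))

isRainbow : {n : ℕ} {G : Graph n} → ProperEdgeColouring G → List (Fin n) → Bool
isRainbow c xs = distinct ℕ._≟_ (map (λ { (u , v) → col c u v }) (cycEdges xs))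

labelledCycles : {n : ℕ} → Graph n → ℕ → List (List (Fin n))
labelledCycles {n} G m = filterᵇ (isLabelledCycle G) (allSeqs m n)

-- For m ≥ 3 every copy of C_m (as a subgraph) arises from exactly 2m
-- labelled cycles (m starting points × 2 directions); rainbowness depends
-- only on the copy.  Hence the numbers of copies are:
rainbowCopiesOf : {n : ℕ} {G : Graph n} → ProperEdgeColouring G →
                  (m : ℕ) → .{{_ : ℕ.NonZero m}} → ℕ
rainbowCopiesOf {G = G} c m =
  length (filterᵇ (isRainbow c) (labelledCycles G m)) / (2 * m) where instance _ = m*n≢0 2 m

nonRainbowCopiesOf : {n : ℕ} {G : Graph n} → ProperEdgeColouring G →
                     (m : ℕ) → .{{_ : ℕ.NonZero m}} → ℕ
nonRainbowCopiesOf {G = G} c m =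
  length (filterᵇ (λ xs → not (isRainbow c xs)) (labelledCycles G m)) / (2 * m) where instance _ = m*n≢0 2 m

-- Work with labelled cycles, vertex sequences v ∷ x ∷ … ∷ e of length m = 3 + k, of which each
-- copy of C_m has 2m.  A non-rainbow one has a rotation in which the colour of the first edge vx
-- reappears, and by properness it reappears on an edge ba of the path x … e.  If x and e have
-- fewer than D common neighbours, the other vertices leave fewer than D choices for v and then at
-- most one for a (the neighbour of b in the colour of vx): O(n^(1+k)) sequences.  If x and e have
-- at least D common neighbours, at most k of them repeat the first colour (one per colour on the
-- path, by properness at x), while at least D − (k + 2) close the path into a cycle.  For
-- D = 2mk + k + 2 these sequences number at most (N + R)/(2m), where N and R count the non-rainbow
-- and rainbow labelled cycles, and absorbing them gives N ≤ O(n^(1+k)) + R.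
module Submission where

open import Data.Bool using (Bool; true; false; T; not; _∧_)
open import Data.Bool.ListAction using (any)
open import Data.Bool.Properties using (T-∧; T-≡; ∧-zeroʳ)
open import Data.Fin using (Fin)
import Data.Fin as Fin
open import Data.List using (List; []; _∷_; [_]; _++_; _∷ʳ_; map; concatMap; filterᵇ; length; allFin; drop; zip; upTo)
open import Data.List.Membership.Propositional using (_∈_; _∉_)
open import Data.List.Membership.Propositional.Properties using (∈-++⁺ˡ; ∈-++⁻; ∈-map⁻; ∈-upTo⁺)
open import Data.List.Properties
  using (length-tabulate; length-upTo; ++-identityʳ; ++-assoc; map-++; length-zipWith; length-map; length-++-≤ˡ; length-++-sucʳ)
open import Data.List.Relation.Binary.Permutation.Propositional using (_↭_; ↭-refl; ↭-sym; ↭-trans; ↭⇒↭ₛ)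
open import Data.List.Relation.Binary.Permutation.Propositional.Properties using (∷↭∷ʳ; ↭-length; All-resp-↭)
import Data.List.Relation.Binary.Permutation.Setoid.Properties as Permₛ
open import Data.List.Relation.Unary.All using (All; []; _∷_)
import Data.List.Relation.Unary.All as All
open import Data.List.Relation.Unary.All.Properties using (¬Any⇒All¬; All¬⇒¬Any; all⁺; all⁻; ∷ʳ⁺; ∷ʳ⁻)
open import Data.List.Relation.Unary.Any using (here; there)
import Data.List.Relation.Unary.Any as Any
open import Data.List.Relation.Unary.Any.Properties using (any⁺; any⁻)
open import Data.List.Relation.Unary.Unique.Propositional using (Unique; []; _∷_)
open import Data.List.Relation.Unary.Unique.Propositional.Properties using (tabulate⁺)
open import Data.Nat
  using (ℕ; zero; suc; _+_; _*_; _^_; _∸_; _⊓_; _≤_; _<_; _≟_; _<?_; _≤?_; z≤n; s≤s; s≤s⁻¹; NonZero)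
import Data.Nat as ℕ
open import Data.Nat.DivMod using (_/_; _%_; m≡m%n+[m/n]*n; m%n<n; m/n≤m; /-monoˡ-≤)
open import Data.Nat.Properties
open import Algebra.Properties.CommutativeSemigroup +-commutativeSemigroup using (interchange)
open import Data.Nat.Solver using (module +-*-Solver)
open +-*-Solver using (solve; _:+_; _:*_; _:=_; con)
open import Data.Product using (∃; ∃₂; _×_; _,_; uncurry)
open import Data.Sum using (_⊎_; inj₁; inj₂)
open import Defs hiding (sym)
open import Function using (_∘_; id; Equivalence; _⇔_; mk⇔)
open import Relation.Binary.Definitions using (DecidableEquality)
open import Relation.Binary.PropositionalEquality hiding ([_])
open import Relation.Nullary using (¬_; Dec; yes; no; contradiction)
open import Relation.Nullary.Decidable using (⌊_⌋; toWitness; fromWitness)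

private
  variable
    A B : Set

-- Finite sums and indicator counts

∑ : List A → (A → ℕ) → ℕ
∑ []       f = 0
∑ (x ∷ xs) f = f x + ∑ xs f

syntax ∑ xs (λ x → e) = ∑[ x ∈ xs ] e

private
  ≡0⇒≤ : ∀ {a b} → a ≡ 0 → a ≤ b
  ≡0⇒≤ refl = z≤n

∑-++ : ∀ (xs ys : List A) f → ∑ (xs ++ ys) f ≡ ∑ xs f + ∑ ys f
∑-++ []       ys f = refl
∑-++ (x ∷ xs) ys f = trans (cong (f x +_) (∑-++ xs ys f)) (sym (+-assoc (f x) _ _))

∑-map : ∀ (g : A → B) xs f → ∑ (map g xs) f ≡ ∑ xs (f ∘ g)
∑-map g []       f = refl
∑-map g (x ∷ xs) f = cong (f (g x) +_) (∑-map g xs f)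

∑-concatMap : ∀ (g : A → List B) xs f → ∑ (concatMap g xs) f ≡ ∑[ x ∈ xs ] ∑ (g x) f
∑-concatMap g []       f = refl
∑-concatMap g (x ∷ xs) f =
  trans (∑-++ (g x) (concatMap g xs) f) (cong (∑ (g x) f +_) (∑-concatMap g xs f))

∑-cong : ∀ (xs : List A) {f g} → (∀ x → f x ≡ g x) → ∑ xs f ≡ ∑ xs g
∑-cong []       eq = refl
∑-cong (x ∷ xs) eq = cong₂ _+_ (eq x) (∑-cong xs eq)

∑-mono : ∀ (xs : List A) {f g} → (∀ x → f x ≤ g x) → ∑ xs f ≤ ∑ xs g
∑-mono []       le = z≤n
∑-mono (x ∷ xs) le = +-mono-≤ (le x) (∑-mono xs le)

∑-+ : ∀ (xs : List A) f g → ∑[ x ∈ xs ] (f x + g x) ≡ ∑ xs f + ∑ xs g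
∑-+ []       f g = refl
∑-+ (x ∷ xs) f g = trans (cong (f x + g x +_) (∑-+ xs f g)) (interchange (f x) (g x) _ _)

∑-*ˡ : ∀ (xs : List A) c f → ∑[ x ∈ xs ] (c * f x) ≡ c * ∑ xs f
∑-*ˡ []       c f = sym (*-zeroʳ c)
∑-*ˡ (x ∷ xs) c f = trans (cong (c * f x +_) (∑-*ˡ xs c f)) (sym (*-distribˡ-+ c (f x) _))

∑-const : ∀ (xs : List A) c → ∑[ _ ∈ xs ] c ≡ length xs * c
∑-const []       c = refl
∑-const (x ∷ xs) c = cong (c +_) (∑-const xs c)

∑-zero : ∀ (xs : List A) → ∑[ _ ∈ xs ] 0 ≡ 0
∑-zero xs = trans (∑-const xs 0) (*-zeroʳ (length xs))

∑-allFin-const : ∀ n c → ∑[ _ ∈ allFin n ] c ≡ n * c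
∑-allFin-const n c = trans (∑-const (allFin n) c) (cong (_* c) (length-tabulate {n = n} id))

∑-comm : ∀ (xs : List A) (ys : List B) (h : A → B → ℕ) →
         ∑[ x ∈ xs ] ∑[ y ∈ ys ] h x y ≡ ∑[ y ∈ ys ] ∑[ x ∈ xs ] h x y
∑-comm []       ys h = sym (∑-zero ys)
∑-comm (x ∷ xs) ys h =
  trans (cong (∑ ys (h x) +_) (∑-comm xs ys h)) (sym (∑-+ ys (h x) (λ y → ∑[ x ∈ xs ] h x y)))

∈⇒≤∑ : ∀ {xs : List A} f {x} → x ∈ xs → f x ≤ ∑ xs f
∈⇒≤∑ f (here refl) = m≤m+n _ _
∈⇒≤∑ f (there x∈)  = ≤-trans (∈⇒≤∑ f x∈) (m≤n+m _ _)

𝟙 : Bool → ℕ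
𝟙 true  = 1
𝟙 false = 0

T⇒𝟙≡1 : ∀ {b} → T b → 𝟙 b ≡ 1
T⇒𝟙≡1 {true} _ = refl

𝟙-split : ∀ a b → 𝟙 b ≡ 𝟙 (a ∧ b) + 𝟙 (not a ∧ b)
𝟙-split true  b = sym (+-identityʳ (𝟙 b))
𝟙-split false b = refl

𝟙-≤-+ : ∀ {a b c} → (T a → T b ⊎ T c) → 𝟙 a ≤ 𝟙 b + 𝟙 c
𝟙-≤-+ {false} _ = z≤n
𝟙-≤-+ {true} {b} {c} a⇒b⊎c with a⇒b⊎c _
... | inj₁ tb = ≤-trans (≤-reflexive (sym (T⇒𝟙≡1 tb))) (m≤m+n (𝟙 b) (𝟙 c))
... | inj₂ tc = ≤-trans (≤-reflexive (sym (T⇒𝟙≡1 tc))) (m≤n+m (𝟙 c) (𝟙 b))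

𝟙-≤-∑ : ∀ {b} {xs : List A} p → (T b → ∃ λ x → x ∈ xs × T (p x)) → 𝟙 b ≤ ∑ xs (𝟙 ∘ p)
𝟙-≤-∑ {b = false} p _ = z≤n
𝟙-≤-∑ {b = true}  p w with x , x∈ , px ← w _ =
  ≤-trans (≤-reflexive (sym (T⇒𝟙≡1 px))) (∈⇒≤∑ (𝟙 ∘ p) x∈)

∑𝟙-guard : ∀ b (xs : List A) p {c} → (T b → ∑ xs (𝟙 ∘ p) ≤ c) → ∑[ x ∈ xs ] 𝟙 (b ∧ p x) ≤ c
∑𝟙-guard false xs p _ = ≡0⇒≤ (∑-zero xs)
∑𝟙-guard true  xs p h = h _

∑𝟙≡0 : ∀ {xs : List A} {p} → All (λ x → ¬ T (p x)) xs → ∑ xs (𝟙 ∘ p) ≡ 0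
∑𝟙≡0 [] = refl
∑𝟙≡0 {xs = x ∷ xs} {p} (¬px ∷ ¬ps) with p x
... | true  = contradiction _ ¬px
... | false = ∑𝟙≡0 ¬ps

∑𝟙≢0⇒∃ : ∀ (xs : List A) p → ∑ xs (𝟙 ∘ p) ≢ 0 → ∃ λ x → T (p x)
∑𝟙≢0⇒∃ []       p ≢0 = contradiction refl ≢0
∑𝟙≢0⇒∃ (x ∷ xs) p ≢0 with p x in px
... | true  = x , subst T (sym px) _
... | false = ∑𝟙≢0⇒∃ xs p ≢0

∑𝟙≤1 : ∀ {xs : List A} p → Unique xs → (∀ {x y} → T (p x) → T (p y) → x ≡ y) → ∑ xs (𝟙 ∘ p) ≤ 1
∑𝟙≤1 p [] _ = z≤n
∑𝟙≤1 {xs = x ∷ xs} p (x∉ ∷ u) unique with p x in px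
... | false = ∑𝟙≤1 p u unique
... | true  = ≤-reflexive (cong suc (∑𝟙≡0 (All.map (λ x≢y py → x≢y (unique (subst T (sym px) _) py)) x∉)))

∑𝟙-allFin≤1 : ∀ {n} (p : Fin n → Bool) → (∀ {x y} → T (p x) → T (p y) → x ≡ y) →
              ∑ (allFin n) (𝟙 ∘ p) ≤ 1
∑𝟙-allFin≤1 p = ∑𝟙≤1 p (tabulate⁺ id)

length-filterᵇ² : ∀ (p q : A → Bool) xs → length (filterᵇ q (filterᵇ p xs)) ≡ ∑[ x ∈ xs ] 𝟙 (q x ∧ p x)
length-filterᵇ² p q []       = refl
length-filterᵇ² p q (x ∷ xs) with p x
... | false rewrite ∧-zeroʳ (q x) = length-filterᵇ² p q xs
... | true with q x
...   | true  = cong suc (length-filterᵇ² p q xs)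
...   | false = length-filterᵇ² p q xs

-- Rotations, cycle edges and paths

rotate : ℕ → List A → List A
rotate zero    xs = xs
rotate (suc a) xs = rotate a (rot xs)

rot-↭ : ∀ (xs : List A) → rot xs ↭ xs
rot-↭ []       = ↭-refl
rot-↭ (x ∷ xs) = ↭-sym (∷↭∷ʳ x xs)

rotate-↭ : ∀ a (xs : List A) → rotate a xs ↭ xs
rotate-↭ zero    xs = ↭-refl
rotate-↭ (suc a) xs = ↭-trans (rotate-↭ a (rot xs)) (rot-↭ xs)

rotate-++ : ∀ (p q : List A) → rotate (length p) (p ++ q) ≡ q ++ p
rotate-++ []      q = sym (++-identityʳ q)
rotate-++ (x ∷ p) q = begin
  rotate (length p) ((p ++ q) ∷ʳ x) ≡⟨ cong (rotate (length p)) (++-assoc p q [ x ]) ⟩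
  rotate (length p) (p ++ q ∷ʳ x)   ≡⟨ rotate-++ p (q ∷ʳ x) ⟩
  (q ∷ʳ x) ++ p                     ≡⟨ ++-assoc q [ x ] p ⟩
  q ++ x ∷ p                        ∎
  where open ≡-Reasoning

map-rotate : ∀ (f : A → B) a xs → map f (rotate a xs) ≡ rotate a (map f xs)
map-rotate f zero    xs       = refl
map-rotate f (suc a) []       = map-rotate f a []
map-rotate f (suc a) (x ∷ xs) = trans (map-rotate f a (xs ∷ʳ x)) (cong (rotate a) (map-++ f xs [ x ]))

zip-∷ʳ : ∀ (xs : List A) (ys : List B) x y → length xs ≡ length ys →
         zip (xs ∷ʳ x) (ys ∷ʳ y) ≡ zip xs ys ∷ʳ (x , y)
zip-∷ʳ []        []        x y _  = refl
zip-∷ʳ (x′ ∷ xs) (y′ ∷ ys) x y eq = cong ((x′ , y′) ∷_) (zip-∷ʳ xs ys x y (suc-injective eq))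

zip-rot : ∀ (xs : List A) (ys : List B) → length xs ≡ length ys → zip (rot xs) (rot ys) ≡ rot (zip xs ys)
zip-rot []       []       _  = refl
zip-rot (x ∷ xs) (y ∷ ys) eq = zip-∷ʳ xs ys x y (suc-injective eq)

cycEdges-rotate : ∀ a (xs : List A) → cycEdges (rotate a xs) ≡ rotate a (cycEdges xs)
cycEdges-rotate zero    xs = refl
cycEdges-rotate (suc a) xs = trans (cycEdges-rotate a (rot xs))
  (cong (rotate a) (zip-rot xs (rot xs) (sym (↭-length (rot-↭ xs)))))

length-cycEdges : ∀ (xs : List A) → length (cycEdges xs) ≡ length xs
length-cycEdges xs = begin
  length (zip xs (rot xs))       ≡⟨ length-zipWith _,_ xs (rot xs) ⟩
  length xs ⊓ length (rot xs)    ≡⟨ cong (length xs ⊓_) (↭-length (rot-↭ xs)) ⟩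
  length xs ⊓ length xs          ≡⟨ ⊓-idem (length xs) ⟩
  length xs                      ∎
  where open ≡-Reasoning

end : A → List A → A
end x []      = x
end x (y ∷ r) = end y r

pathEdges : A → List A → List (A × A)
pathEdges x []      = []
pathEdges x (y ∷ r) = (x , y) ∷ pathEdges y r

cycEdges-∷∷ : ∀ (v x : A) r → cycEdges (v ∷ x ∷ r) ≡ (v , x) ∷ pathEdges x r ∷ʳ (end x r , v)
cycEdges-∷∷ v x r = cong ((v , x) ∷_) (zip-path x r)
  where
  zip-path : ∀ x r → zip (x ∷ r) (r ∷ʳ v) ≡ pathEdges x r ∷ʳ (end x r , v)
  zip-path x []      = refl
  zip-path x (y ∷ r) = cong ((x , y) ∷_) (zip-path y r)

length-pathEdges : ∀ (x : A) r → length (pathEdges x r) ≡ length r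
length-pathEdges x []      = refl
length-pathEdges x (y ∷ r) = cong suc (length-pathEdges y r)

∈-pathEdges⁻ : ∀ {a b : A} x r → (a , b) ∈ pathEdges x r → ∃₂ λ p s → x ∷ r ≡ p ++ a ∷ b ∷ s
∈-pathEdges⁻ x (y ∷ r) (here refl) = [] , r , refl
∈-pathEdges⁻ x (y ∷ r) (there e∈) with p , s , eq ← ∈-pathEdges⁻ y r e∈ = x ∷ p , s , cong (x ∷_) eq

end-++ : ∀ (x : A) p y s → end x (p ++ y ∷ s) ≡ end y s
end-++ x []      y s = refl
end-++ x (z ∷ p) y s = end-++ z p y s

end∈ : ∀ (x : A) r → end x r ∈ x ∷ r
end∈ x []      = here refl
end∈ x (y ∷ r) = there (end∈ y r)

drop-length-++ : ∀ (p q : List A) → drop (length p) (p ++ q) ≡ q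
drop-length-++ []      q = refl
drop-length-++ (x ∷ p) q = drop-length-++ p q

length-drop≤1 : ∀ i (xs : List A) → length xs ≤ suc i → length (drop i xs) ≤ 1
length-drop≤1 zero    xs       ∣xs∣≤ = ∣xs∣≤
length-drop≤1 (suc i) []       _     = z≤n
length-drop≤1 (suc i) (x ∷ xs) ∣xs∣≤ = length-drop≤1 i xs (s≤s⁻¹ ∣xs∣≤)

private
  T-not : ∀ {b} → T (not b) ⇔ (¬ T b)
  T-not {false} = mk⇔ (λ _ ()) (λ _ → _)
  T-not {true}  = mk⇔ (λ ()) (λ ¬t → ¬t _)

module _ (_≟ᴬ_ : DecidableEquality A) where

  occurs : A → List A → Bool
  occurs x = any (λ y → ⌊ x ≟ᴬ y ⌋)

  occurs⁺ : ∀ {x xs} → x ∈ xs → T (occurs x xs)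
  occurs⁺ x∈ = any⁺ _ (Any.map fromWitness x∈)

  occurs⁻ : ∀ {x} xs → T (occurs x xs) → x ∈ xs
  occurs⁻ xs t = Any.map toWitness (any⁻ _ xs t)

  distinct⇒Unique : ∀ xs → T (distinct _≟ᴬ_ xs) → Unique xs
  distinct⇒Unique []       _ = []
  distinct⇒Unique (x ∷ xs) t with x∉ , u ← Equivalence.to T-∧ t =
    ¬Any⇒All¬ xs (Equivalence.to T-not x∉ ∘ occurs⁺) ∷ distinct⇒Unique xs u

  Unique⇒distinct : ∀ {xs} → Unique xs → T (distinct _≟ᴬ_ xs)
  Unique⇒distinct []                = _
  Unique⇒distinct {x ∷ xs} (x∉ ∷ u) =
    Equivalence.from T-∧ (Equivalence.from T-not (All¬⇒¬Any x∉ ∘ occurs⁻ xs) , Unique⇒distinct u)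

  ¬distinct⇒repeat : ∀ xs → T (not (distinct _≟ᴬ_ xs)) → ∃₂ λ p q → ∃ λ y → xs ≡ p ++ y ∷ q × y ∈ q
  ¬distinct⇒repeat (x ∷ xs) t with occurs x xs in eq
  ... | true  = [] , xs , x , refl , occurs⁻ xs (subst T (sym eq) _)
  ... | false with p , q , y , refl , y∈ ← ¬distinct⇒repeat xs t = x ∷ p , q , y , refl , y∈

-- Sums over all vertex sequences of a given length

module _ {n : ℕ} where

  ∑-allSeqs-suc : ∀ k f → ∑ (allSeqs (suc k) n) f ≡ ∑[ t ∈ allSeqs k n ] ∑[ v ∈ allFin n ] f (v ∷ t)
  ∑-allSeqs-suc k f = trans (∑-concatMap (λ t → map (_∷ t) (allFin n)) (allSeqs k n) f)
                            (∑-cong (allSeqs k n) (λ t → ∑-map (_∷ t) (allFin n) f))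

  ∑-allSeqs-∷ʳ : ∀ k f → ∑ (allSeqs (suc k) n) f ≡ ∑[ t ∈ allSeqs k n ] ∑[ v ∈ allFin n ] f (t ∷ʳ v)
  ∑-allSeqs-∷ʳ zero    f = ∑-allSeqs-suc zero f
  ∑-allSeqs-∷ʳ (suc k) f = begin
    ∑ (allSeqs (suc (suc k)) n) f
      ≡⟨ ∑-allSeqs-suc (suc k) f ⟩
    ∑[ t ∈ allSeqs (suc k) n ] ∑[ v ∈ allFin n ] f (v ∷ t)
      ≡⟨ ∑-allSeqs-∷ʳ k _ ⟩
    ∑[ t ∈ allSeqs k n ] ∑[ w ∈ allFin n ] ∑[ v ∈ allFin n ] f (v ∷ t ∷ʳ w)
      ≡⟨ ∑-cong (allSeqs k n) (λ t → ∑-comm (allFin n) (allFin n) _) ⟩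
    ∑[ t ∈ allSeqs k n ] ∑[ v ∈ allFin n ] ∑[ w ∈ allFin n ] f (v ∷ t ∷ʳ w)
      ≡⟨ ∑-allSeqs-suc k _ ⟨
    ∑[ t ∈ allSeqs (suc k) n ] ∑[ w ∈ allFin n ] f (t ∷ʳ w) ∎
    where open ≡-Reasoning

  ∑-allSeqs-rot : ∀ k f → ∑ (allSeqs k n) (f ∘ rot) ≡ ∑ (allSeqs k n) f
  ∑-allSeqs-rot zero    f = refl
  ∑-allSeqs-rot (suc k) f = trans (∑-allSeqs-suc k (f ∘ rot)) (sym (∑-allSeqs-∷ʳ k f))

  ∑-allSeqs-rotate : ∀ k a f → ∑ (allSeqs k n) (f ∘ rotate a) ≡ ∑ (allSeqs k n) f
  ∑-allSeqs-rotate k zero    f = refl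
  ∑-allSeqs-rotate k (suc a) f = trans (∑-allSeqs-rot k (f ∘ rotate a)) (∑-allSeqs-rotate k a f)

  ∑-allSeqs-rotations : ∀ k f → ∑[ xs ∈ allSeqs k n ] ∑[ a ∈ upTo k ] f (rotate a xs) ≡ k * ∑ (allSeqs k n) f
  ∑-allSeqs-rotations k f = begin
    ∑[ xs ∈ allSeqs k n ] ∑[ a ∈ upTo k ] f (rotate a xs) ≡⟨ ∑-comm (allSeqs k n) (upTo k) _ ⟩
    ∑[ a ∈ upTo k ] ∑ (allSeqs k n) (f ∘ rotate a)        ≡⟨ ∑-cong (upTo k) (λ a → ∑-allSeqs-rotate k a f) ⟩
    ∑[ _ ∈ upTo k ] ∑ (allSeqs k n) f                     ≡⟨ ∑-const (upTo k) _ ⟩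
    length (upTo k) * ∑ (allSeqs k n) f                   ≡⟨ cong (_* ∑ (allSeqs k n) f) (length-upTo k) ⟩
    k * ∑ (allSeqs k n) f                                 ∎
    where open ≡-Reasoning

  ∑-allSeqs-mono : ∀ k {f g} → (∀ xs → length xs ≡ k → f xs ≤ g xs) → ∑ (allSeqs k n) f ≤ ∑ (allSeqs k n) g
  ∑-allSeqs-mono zero    le = +-mono-≤ (le [] refl) z≤n
  ∑-allSeqs-mono (suc k) {f} {g} le = begin
    ∑ (allSeqs (suc k) n) f
      ≡⟨ ∑-allSeqs-suc k f ⟩
    ∑[ t ∈ allSeqs k n ] ∑[ v ∈ allFin n ] f (v ∷ t)
      ≤⟨ ∑-allSeqs-mono k (λ t ∣t∣ → ∑-mono (allFin n) (λ v → le (v ∷ t) (cong suc ∣t∣))) ⟩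
    ∑[ t ∈ allSeqs k n ] ∑[ v ∈ allFin n ] g (v ∷ t)
      ≡⟨ ∑-allSeqs-suc k g ⟨
    ∑ (allSeqs (suc k) n) g ∎
    where open ≤-Reasoning

  ∑-allSeqs-const : ∀ k c → ∑[ _ ∈ allSeqs k n ] c ≡ n ^ k * c
  ∑-allSeqs-const zero    c = refl
  ∑-allSeqs-const (suc k) c = begin
    ∑[ _ ∈ allSeqs (suc k) n ] c              ≡⟨ ∑-allSeqs-suc k _ ⟩
    ∑[ _ ∈ allSeqs k n ] ∑[ _ ∈ allFin n ] c  ≡⟨ ∑-cong (allSeqs k n) (λ _ → ∑-allFin-const n c) ⟩
    ∑[ _ ∈ allSeqs k n ] (n * c)              ≡⟨ ∑-allSeqs-const k (n * c) ⟩
    n ^ k * (n * c)                           ≡⟨ *-assoc (n ^ k) n c ⟨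
    n ^ k * n * c                             ≡⟨ cong (_* c) (*-comm (n ^ k) n) ⟩
    n ^ suc k * c                             ∎
    where open ≡-Reasoning

  ∑-allSeqs-≤ : ∀ k {f} c → (∀ xs → f xs ≤ c) → ∑ (allSeqs k n) f ≤ n ^ k * c
  ∑-allSeqs-≤ k c f≤c = ≤-trans (∑-mono (allSeqs k n) f≤c) (≤-reflexive (∑-allSeqs-const k c))

  ∑-allSeqs-drop : ∀ i k g → ∑ (allSeqs (i + k) n) (g ∘ drop i) ≡ n ^ i * ∑ (allSeqs k n) g
  ∑-allSeqs-drop zero    k g = sym (+-identityʳ _)
  ∑-allSeqs-drop (suc i) k g = begin
    ∑ (allSeqs (suc i + k) n) (g ∘ drop (suc i))
      ≡⟨ ∑-allSeqs-suc (i + k) _ ⟩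
    ∑[ t ∈ allSeqs (i + k) n ] ∑[ _ ∈ allFin n ] g (drop i t)
      ≡⟨ ∑-cong (allSeqs (i + k) n) (λ t → ∑-allFin-const n _) ⟩
    ∑[ t ∈ allSeqs (i + k) n ] (n * g (drop i t))
      ≡⟨ ∑-*ˡ (allSeqs (i + k) n) n (g ∘ drop i) ⟩
    n * ∑ (allSeqs (i + k) n) (g ∘ drop i)
      ≡⟨ cong (n *_) (∑-allSeqs-drop i k g) ⟩
    n * (n ^ i * ∑ (allSeqs k n) g)
      ≡⟨ *-assoc n (n ^ i) _ ⟨
    n ^ suc i * ∑ (allSeqs k n) g ∎
    where open ≡-Reasoning

-- Labelled cycles

module _ {n : ℕ} (G : Graph n) where

  Adj : Fin n → Fin n → Set
  Adj u v = T (adj G u v)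

  adj-sym : ∀ {u v} → Adj u v → Adj v u
  adj-sym {u} {v} = subst T (Graph.sym G u v)

  record IsPath (x : Fin n) (r : List (Fin n)) : Set where
    field
      unique : Unique (x ∷ r)
      steps  : All (uncurry Adj) (pathEdges x r)

  record ClosesCycle (v x : Fin n) (r : List (Fin n)) : Set where
    field
      fresh   : v ∉ x ∷ r
      path    : IsPath x r
      first   : Adj v x
      closing : Adj (end x r) v

  isLabelledCycle⁻ : ∀ xs → T (isLabelledCycle G xs) → Unique xs × All (uncurry Adj) (cycEdges xs)
  isLabelledCycle⁻ xs t with d , a ← Equivalence.to T-∧ t = distinct⇒Unique Fin._≟_ xs d , all⁺ _ (cycEdges xs) a

  isLabelledCycle⁺ : ∀ {xs} → Unique xs → All (uncurry Adj) (cycEdges xs) → T (isLabelledCycle G xs)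
  isLabelledCycle⁺ u a = Equivalence.from T-∧ (Unique⇒distinct Fin._≟_ u , all⁻ _ a)

  isLabelledCycle-rotate : ∀ a xs → T (isLabelledCycle G xs) → T (isLabelledCycle G (rotate a xs))
  isLabelledCycle-rotate a xs t with u , e ← isLabelledCycle⁻ xs t = isLabelledCycle⁺
    (Permₛ.Unique-resp-↭ (setoid (Fin n)) (↭⇒↭ₛ (↭-sym (rotate-↭ a xs))) u)
    (subst (All (uncurry Adj)) (sym (cycEdges-rotate a xs)) (All-resp-↭ (↭-sym (rotate-↭ a (cycEdges xs))) e))

  isLabelledCycle⇒ClosesCycle : ∀ v x r → T (isLabelledCycle G (v ∷ x ∷ r)) → ClosesCycle v x r
  isLabelledCycle⇒ClosesCycle v x r t
    with v∉ ∷ u , e ← isLabelledCycle⁻ (v ∷ x ∷ r) t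
    with vx ∷ e′ ← subst (All (uncurry Adj)) (cycEdges-∷∷ v x r) e
    with steps , closing ← ∷ʳ⁻ e′
    = record { fresh = All¬⇒¬Any v∉ ; path = record { unique = u ; steps = steps } ; first = vx ; closing = closing }

  ClosesCycle⇒isLabelledCycle : ∀ {v x r} → ClosesCycle v x r → T (isLabelledCycle G (v ∷ x ∷ r))
  ClosesCycle⇒isLabelledCycle {v} {x} {r} cc = isLabelledCycle⁺
    (¬Any⇒All¬ (x ∷ r) fresh ∷ unique)
    (subst (All (uncurry Adj)) (sym (cycEdges-∷∷ v x r)) (first ∷ ∷ʳ⁺ steps closing))
    where
    open ClosesCycle cc
    open IsPath path

  codegree : Fin n → Fin n → ℕ
  codegree x y = ∑[ v ∈ allFin n ] 𝟙 (adj G v x ∧ adj G v y)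

  ∑-occurs≤length : ∀ xs → ∑[ v ∈ allFin n ] 𝟙 (occurs Fin._≟_ v xs) ≤ length xs
  ∑-occurs≤length xs = begin
    ∑[ v ∈ allFin n ] 𝟙 (occurs Fin._≟_ v xs)
      ≤⟨ ∑-mono (allFin n) (λ v → 𝟙-≤-∑ (same v) (occurrence v)) ⟩
    ∑[ v ∈ allFin n ] ∑[ y ∈ xs ] 𝟙 (same v y)
      ≡⟨ ∑-comm (allFin n) xs _ ⟩
    ∑[ y ∈ xs ] ∑[ v ∈ allFin n ] 𝟙 (same v y)
      ≤⟨ ∑-mono xs (λ y → ∑𝟙-allFin≤1 (λ v → same v y) same-unique) ⟩
    ∑[ _ ∈ xs ] 1
      ≡⟨ trans (∑-const xs 1) (*-identityʳ _) ⟩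
    length xs ∎
    where
    open ≤-Reasoning
    same : Fin n → Fin n → Bool
    same v y = ⌊ v Fin.≟ y ⌋
    occurrence : ∀ v → T (occurs Fin._≟_ v xs) → ∃ λ y → y ∈ xs × T (same v y)
    occurrence v t = v , occurs⁻ Fin._≟_ xs t , fromWitness refl
    same-unique : ∀ {y v w} → T (same v y) → T (same w y) → v ≡ w
    same-unique t t′ = trans (toWitness t) (sym (toWitness t′))

  codegree≤closings : ∀ {x r} → IsPath x r →
    codegree x (end x r) ≤ ∑[ v ∈ allFin n ] 𝟙 (isLabelledCycle G (v ∷ x ∷ r)) + suc (length r)
  codegree≤closings {x} {r} path = begin
    codegree x (end x r)
      ≤⟨ ∑-mono (allFin n) (λ v → 𝟙-≤-+ (closes-or-occurs v)) ⟩
    ∑[ v ∈ allFin n ] (𝟙 (isLabelledCycle G (v ∷ x ∷ r)) + 𝟙 (occurs Fin._≟_ v (x ∷ r)))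
      ≡⟨ ∑-+ (allFin n) _ _ ⟩
    ∑[ v ∈ allFin n ] 𝟙 (isLabelledCycle G (v ∷ x ∷ r)) + ∑[ v ∈ allFin n ] 𝟙 (occurs Fin._≟_ v (x ∷ r))
      ≤⟨ +-monoʳ-≤ _ (∑-occurs≤length (x ∷ r)) ⟩
    ∑[ v ∈ allFin n ] 𝟙 (isLabelledCycle G (v ∷ x ∷ r)) + suc (length r) ∎
    where
    open ≤-Reasoning
    closes-or-occurs : ∀ v → T (adj G v x ∧ adj G v (end x r)) →
                       T (isLabelledCycle G (v ∷ x ∷ r)) ⊎ T (occurs Fin._≟_ v (x ∷ r))
    closes-or-occurs v t with Any.any? (v Fin.≟_) (x ∷ r)
    ... | yes v∈ = inj₂ (occurs⁺ Fin._≟_ v∈)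
    ... | no  v∉ with vx , ve ← Equivalence.to T-∧ t =
      inj₁ (ClosesCycle⇒isLabelledCycle record { fresh = v∉ ; path = path ; first = vx ; closing = adj-sym ve })

-- Properly coloured cycles

module _ {n : ℕ} {G : Graph n} (c : ProperEdgeColouring G) where

  colour : Fin n × Fin n → ℕ
  colour (u , v) = col c u v

  colours : List (Fin n) → List ℕ
  colours xs = map colour (cycEdges xs)

  pathColours : Fin n → List (Fin n) → List ℕ
  pathColours x r = map colour (pathEdges x r)

  colours-∷∷ : ∀ v x r → colours (v ∷ x ∷ r) ≡ col c v x ∷ pathColours x r ∷ʳ col c (end x r) v
  colours-∷∷ v x r =
    trans (cong (map colour) (cycEdges-∷∷ v x r)) (cong (col c v x ∷_) (map-++ colour (pathEdges x r) _))

  col-sym : ∀ {u v} → Adj G u v → col c u v ≡ col c v u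
  col-sym {u} {v} = colSym c u v ∘ Equivalence.to T-≡

  col-injective : ∀ {u v w} → Adj G u v → Adj G u w → col c u v ≡ col c u w → v ≡ w
  col-injective {u} {v} {w} uv uw eq with v Fin.≟ w
  ... | yes v≡w = v≡w
  ... | no  v≢w = contradiction eq (proper c u v w (Equivalence.to T-≡ uv) (Equivalence.to T-≡ uw) v≢w)

  ∑-colourClass≤1 : ∀ u K → ∑[ w ∈ allFin n ] 𝟙 (adj G u w ∧ ⌊ col c u w ℕ.≟ K ⌋) ≤ 1
  ∑-colourClass≤1 u K = ∑𝟙-allFin≤1 _ λ tw tw′ →
    let uw , w≡ = Equivalence.to T-∧ tw ; uw′ , w′≡ = Equivalence.to T-∧ tw′
    in col-injective uw uw′ (trans (toWitness w≡) (sym (toWitness w′≡)))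

  headRepeats : List ℕ → Bool
  headRepeats []       = false
  headRepeats (K ∷ Ks) = occurs ℕ._≟_ K Ks

  repeatsFirstColour : List (Fin n) → Bool
  repeatsFirstColour xs = headRepeats (colours xs) ∧ isLabelledCycle G xs

  nonRainbow⇒rotate : ∀ xs → T (isLabelledCycle G xs) → T (not (isRainbow c xs)) →
                      ∃ λ a → a < length xs × T (repeatsFirstColour (rotate a xs))
  nonRainbow⇒rotate xs cyc nonRainbow
    with p , q , K , eq , K∈q ← ¬distinct⇒repeat ℕ._≟_ (colours xs) nonRainbow
    = length p , p<xs , Equivalence.from T-∧ (head , isLabelledCycle-rotate G (length p) xs cyc)
    where
    colours-rotate : colours (rotate (length p) xs) ≡ K ∷ q ++ p
    colours-rotate = begin
      map colour (cycEdges (rotate (length p) xs))  ≡⟨ cong (map colour) (cycEdges-rotate (length p) xs) ⟩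
      map colour (rotate (length p) (cycEdges xs))  ≡⟨ map-rotate colour (length p) (cycEdges xs) ⟩
      rotate (length p) (colours xs)                ≡⟨ cong (rotate (length p)) eq ⟩
      rotate (length p) (p ++ K ∷ q)                ≡⟨ rotate-++ p (K ∷ q) ⟩
      K ∷ q ++ p                                    ∎
      where open ≡-Reasoning
    head : T (headRepeats (colours (rotate (length p) xs)))
    head = subst (T ∘ headRepeats) (sym colours-rotate) (occurs⁺ ℕ._≟_ (∈-++⁺ˡ K∈q))
    p<xs : length p < length xs
    p<xs = begin-strict
      length p               <⟨ s≤s (length-++-≤ˡ p) ⟩
      suc (length (p ++ q))  ≡⟨ length-++-sucʳ p K q ⟨
      length (p ++ K ∷ q)    ≡⟨ cong length eq ⟨
      length (colours xs)    ≡⟨ length-map colour (cycEdges xs) ⟩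
      length (cycEdges xs)   ≡⟨ length-cycEdges xs ⟩
      length xs              ∎
      where open ≤-Reasoning

  repeatedFirstColour∈path : ∀ v x y r → T (repeatsFirstColour (v ∷ x ∷ y ∷ r)) →
                             ClosesCycle G v x (y ∷ r) × col c v x ∈ pathColours y r
  repeatedFirstColour∈path v x y r t with rep , cyc ← Equivalence.to T-∧ t = cc , on-path repeats
    where
    cc = isLabelledCycle⇒ClosesCycle G v x (y ∷ r) cyc
    open ClosesCycle cc
    open IsPath path
    repeats : col c v x ∈ col c x y ∷ pathColours y r ∷ʳ col c (end y r) v
    repeats = occurs⁻ ℕ._≟_ _ (subst (T ∘ headRepeats) (colours-∷∷ v x (y ∷ r)) rep)
    on-path : col c v x ∈ col c x y ∷ pathColours y r ∷ʳ col c (end y r) v → col c v x ∈ pathColours y r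
    on-path (here vx≡xy) with xy ∷ _ ← steps =
      contradiction (col-injective (adj-sym G first) xy (trans (sym (col-sym first)) vx≡xy))
                    (λ v≡y → fresh (there (here v≡y)))
    on-path (there K∈) with ∈-++⁻ (pathColours y r) K∈
    ... | inj₁ K∈path      = K∈path
    ... | inj₂ (here vx≡ev) with x∉ ∷ _ ← unique =
      contradiction (col-injective first (adj-sym G closing) (trans vx≡ev (col-sym closing)))
                    (All.lookup x∉ (end∈ y r))

  ∑-repeatsFirstColour≤ : ∀ x y r → ∑[ v ∈ allFin n ] 𝟙 (repeatsFirstColour (v ∷ x ∷ y ∷ r)) ≤ length r
  ∑-repeatsFirstColour≤ x y r = begin
    ∑[ v ∈ allFin n ] 𝟙 (repeatsFirstColour (v ∷ x ∷ y ∷ r))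
      ≤⟨ ∑-mono (allFin n) (λ v → 𝟙-≤-∑ (λ K → adj G x v ∧ ⌊ col c x v ℕ.≟ K ⌋) (colour-on-path v)) ⟩
    ∑[ v ∈ allFin n ] ∑[ K ∈ pathColours y r ] 𝟙 (adj G x v ∧ ⌊ col c x v ℕ.≟ K ⌋)
      ≡⟨ ∑-comm (allFin n) (pathColours y r) _ ⟩
    ∑[ K ∈ pathColours y r ] ∑[ v ∈ allFin n ] 𝟙 (adj G x v ∧ ⌊ col c x v ℕ.≟ K ⌋)
      ≤⟨ ∑-mono (pathColours y r) (∑-colourClass≤1 x) ⟩
    ∑[ _ ∈ pathColours y r ] 1
      ≡⟨ trans (∑-const (pathColours y r) 1) (*-identityʳ _) ⟩
    length (pathColours y r)
      ≡⟨ trans (length-map colour (pathEdges y r)) (length-pathEdges y r) ⟩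
    length r ∎
    where
    open ≤-Reasoning
    colour-on-path : ∀ v → T (repeatsFirstColour (v ∷ x ∷ y ∷ r)) →
                     ∃ λ K → K ∈ pathColours y r × T (adj G x v ∧ ⌊ col c x v ℕ.≟ K ⌋)
    colour-on-path v t with cc , K∈ ← repeatedFirstColour∈path v x y r t =
      col c v x , K∈ , Equivalence.from T-∧ (adj-sym G first , fromWitness (col-sym (adj-sym G first)))
      where open ClosesCycle cc

  -- At most length r of the codegree(x, e) ≥ D vertices v repeat the first colour, and at least
  -- s * length r of them close a cycle: codegree≤closings loses only the 2 + length r path vertices.
  ∑-highCodegree≤ : ∀ {D} s x y r → s * length r + suc (suc (length r)) ≤ D →
    s * ∑[ v ∈ allFin n ] 𝟙 (not ⌊ codegree G x (end y r) <? D ⌋ ∧ repeatsFirstColour (v ∷ x ∷ y ∷ r))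
      ≤ ∑[ v ∈ allFin n ] 𝟙 (isLabelledCycle G (v ∷ x ∷ y ∷ r))
  ∑-highCodegree≤ {D} s x y r D-large with codegree G x (end y r) <? D
  ... | yes _   = ≡0⇒≤ (trans (cong (s *_) (∑-zero (allFin n))) (*-zeroʳ s))
  ... | no high with ∑[ v ∈ allFin n ] 𝟙 (repeatsFirstColour (v ∷ x ∷ y ∷ r)) ≟ 0
  ...   | yes none = ≡0⇒≤ (trans (cong (s *_) none) (*-zeroʳ s))
  ...   | no some  = begin
    s * ∑[ v ∈ allFin n ] 𝟙 (repeatsFirstColour (v ∷ x ∷ y ∷ r))
      ≤⟨ *-monoʳ-≤ s (∑-repeatsFirstColour≤ x y r) ⟩
    s * length r
      ≤⟨ +-cancelʳ-≤ _ _ _ (≤-trans D-large (≤-trans (≮⇒≥ high) closings)) ⟩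
    ∑[ v ∈ allFin n ] 𝟙 (isLabelledCycle G (v ∷ x ∷ y ∷ r)) ∎
    where
    open ≤-Reasoning
    closings : codegree G x (end y r)
             ≤ ∑[ v ∈ allFin n ] 𝟙 (isLabelledCycle G (v ∷ x ∷ y ∷ r)) + suc (suc (length r))
    closings with v , t ← ∑𝟙≢0⇒∃ (allFin n) _ some with cc , _ ← repeatedFirstColour∈path v x y r t =
      codegree≤closings G (ClosesCycle.path cc)

  lowCodegree : ℕ → List (Fin n) → Bool
  lowCodegree D (v ∷ x ∷ r) = ⌊ codegree G x (end x r) <? D ⌋
  lowCodegree D _           = false

  -- The argument a ∷ b ∷ s is the suffix of the path after x that starts at the repeated edge,
  -- so end b s is the end of the path.
  lowRepeatHere : ℕ → Fin n → Fin n → List (Fin n) → Bool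
  lowRepeatHere D v x (a ∷ b ∷ s) =
    (⌊ codegree G x (end b s) <? D ⌋ ∧ (adj G v x ∧ adj G v (end b s))) ∧ (adj G b a ∧ ⌊ col c b a ℕ.≟ col c v x ⌋)
  lowRepeatHere D v x _           = false

  lowRepeatAt : ℕ → ℕ → List (Fin n) → Bool
  lowRepeatAt D i (v ∷ x ∷ r) = lowRepeatHere D v x (drop i r)
  lowRepeatAt D i _           = false

  lowRepeat⇒lowRepeatAt : ∀ {D} v x y r →
    T (⌊ codegree G x (end y r) <? D ⌋ ∧ repeatsFirstColour (v ∷ x ∷ y ∷ r)) →
    ∃ λ i → i ∈ upTo (suc (length r)) × T (lowRepeatAt D i (v ∷ x ∷ y ∷ r))
  lowRepeat⇒lowRepeatAt {D} v x y r t
    with low , rep ← Equivalence.to T-∧ t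
    with cc , K∈ ← repeatedFirstColour∈path v x y r rep
    with (a , b) , ab∈ , vx≡ab ← ∈-map⁻ colour K∈
    with p , s , path≡ ← ∈-pathEdges⁻ y r ab∈
    = length p , ∈-upTo⁺ p<path , subst (T ∘ lowRepeatHere D v x) (sym drop≡) repeatHere
    where
    open ClosesCycle cc
    open IsPath path
    drop≡ : drop (length p) (y ∷ r) ≡ a ∷ b ∷ s
    drop≡ = trans (cong (drop (length p)) path≡) (drop-length-++ p _)
    p<path : length p < suc (length r)
    p<path = begin-strict
      length p                   <⟨ s≤s (length-++-≤ˡ p) ⟩
      suc (length (p ++ b ∷ s))  ≡⟨ length-++-sucʳ p a (b ∷ s) ⟨
      length (p ++ a ∷ b ∷ s)    ≡⟨ cong length path≡ ⟨
      suc (length r)             ∎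
      where open ≤-Reasoning
    end≡ : end y r ≡ end b s
    end≡ = trans (cong (end x) path≡) (end-++ x p a (b ∷ s))
    ab : Adj G a b
    ab with _ ∷ path-steps ← steps = All.lookup path-steps ab∈
    repeatHere : T (lowRepeatHere D v x (a ∷ b ∷ s))
    repeatHere = Equivalence.from T-∧
      ( Equivalence.from T-∧
          ( subst (λ e → T ⌊ codegree G x e <? D ⌋) end≡ low
          , Equivalence.from T-∧ (first , subst (Adj G v) end≡ (adj-sym G closing)))
      , Equivalence.from T-∧ (adj-sym G ab , fromWitness (trans (col-sym (adj-sym G ab)) (sym vx≡ab))))

  lowRepeatCount : ℕ → List (Fin n) → ℕ
  lowRepeatCount D s = ∑[ x ∈ allFin n ] ∑[ v ∈ allFin n ] 𝟙 (lowRepeatHere D v x s)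

  private
    ∑²-zero : ∑[ x ∈ allFin n ] ∑[ v ∈ allFin n ] 0 ≡ 0
    ∑²-zero = trans (∑-cong (allFin n) (λ _ → ∑-zero (allFin n))) (∑-zero (allFin n))

  lowRepeatCount-short : ∀ D s → length s ≤ 1 → lowRepeatCount D s ≡ 0
  lowRepeatCount-short D []          _       = ∑²-zero
  lowRepeatCount-short D (_ ∷ [])    _       = ∑²-zero
  lowRepeatCount-short D (_ ∷ _ ∷ _) (s≤s ())

  -- Given b and the colour of v x, properness leaves at most one a; and v ranges over the fewer
  -- than D common neighbours of x and the end of the path.
  ∑-lowRepeatCount≤ : ∀ D b r → ∑[ a ∈ allFin n ] lowRepeatCount D (a ∷ b ∷ r) ≤ n * D
  ∑-lowRepeatCount≤ D b r = begin
    ∑[ a ∈ allFin n ] ∑[ x ∈ allFin n ] ∑[ v ∈ allFin n ] 𝟙 (common v x ∧ repeats a v x)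
      ≡⟨ trans (∑-comm (allFin n) (allFin n) _) (∑-cong (allFin n) (λ x → ∑-comm (allFin n) (allFin n) _)) ⟩
    ∑[ x ∈ allFin n ] ∑[ v ∈ allFin n ] ∑[ a ∈ allFin n ] 𝟙 (common v x ∧ repeats a v x)
      ≤⟨ ∑-mono (allFin n) (λ x → ∑-mono (allFin n) (λ v → ∑𝟙-guard (common v x) (allFin n) (λ a → repeats a v x) (at-most-one-a v x))) ⟩
    ∑[ x ∈ allFin n ] ∑[ v ∈ allFin n ] 𝟙 (common v x)
      ≤⟨ ∑-mono (allFin n) (λ x → ∑𝟙-guard ⌊ codegree G x (end b r) <? D ⌋ (allFin n) _ (<⇒≤ ∘ toWitness)) ⟩
    ∑[ _ ∈ allFin n ] D
      ≡⟨ ∑-allFin-const n D ⟩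
    n * D ∎
    where
    open ≤-Reasoning
    common : Fin n → Fin n → Bool
    common v x = ⌊ codegree G x (end b r) <? D ⌋ ∧ (adj G v x ∧ adj G v (end b r))
    repeats : Fin n → Fin n → Fin n → Bool
    repeats a v x = adj G b a ∧ ⌊ col c b a ℕ.≟ col c v x ⌋
    at-most-one-a : ∀ v x → T (common v x) → ∑[ a ∈ allFin n ] 𝟙 (repeats a v x) ≤ 𝟙 (common v x)
    at-most-one-a v x t = subst (∑[ a ∈ allFin n ] 𝟙 (repeats a v x) ≤_) (sym (T⇒𝟙≡1 t)) (∑-colourClass≤1 b (col c v x))

  ∑-allSeqs-lowRepeatCount≤ : ∀ D j → ∑ (allSeqs (2 + j) n) (lowRepeatCount D) ≤ n ^ suc j * (n * D)
  ∑-allSeqs-lowRepeatCount≤ D j = begin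
    ∑ (allSeqs (2 + j) n) (lowRepeatCount D)                             ≡⟨ ∑-allSeqs-suc (suc j) _ ⟩
    ∑[ t ∈ allSeqs (suc j) n ] ∑[ a ∈ allFin n ] lowRepeatCount D (a ∷ t) ≤⟨ ∑-allSeqs-≤ (suc j) (n * D) per-tail ⟩
    n ^ suc j * (n * D)                                                   ∎
    where
    open ≤-Reasoning
    per-tail : ∀ t → ∑[ a ∈ allFin n ] lowRepeatCount D (a ∷ t) ≤ n * D
    per-tail []      =
      ≡0⇒≤ (trans (∑-cong (allFin n) (λ a → lowRepeatCount-short D (a ∷ []) ≤-refl)) (∑-zero (allFin n)))
    per-tail (b ∷ r) = ∑-lowRepeatCount≤ D b r

  ∑-lowRepeatAt≤ : ∀ D i k → ∑[ xs ∈ allSeqs (2 + k) n ] 𝟙 (lowRepeatAt D i xs) ≤ D * n ^ k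
  ∑-lowRepeatAt≤ D i k = begin
    ∑[ xs ∈ allSeqs (2 + k) n ] 𝟙 (lowRepeatAt D i xs)  ≡⟨ trans (∑-allSeqs-suc (suc k) _) (∑-allSeqs-suc k _) ⟩
    ∑[ r ∈ allSeqs k n ] lowRepeatCount D (drop i r)     ≤⟨ bound (2 + i ≤? k) ⟩
    D * n ^ k                                            ∎
    where
    open ≤-Reasoning
    bound : Dec (2 + i ≤ k) → ∑[ r ∈ allSeqs k n ] lowRepeatCount D (drop i r) ≤ D * n ^ k
    bound (no k<2+i) = ≤-trans
      (∑-allSeqs-mono k {g = λ _ → 0} (λ r ∣r∣ → ≤-reflexive (lowRepeatCount-short D (drop i r) (short r ∣r∣))))
      (≡0⇒≤ (trans (∑-allSeqs-const k 0) (*-zeroʳ (n ^ k))))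
      where
      short : ∀ r → length r ≡ k → length (drop i r) ≤ 1
      short r refl = length-drop≤1 i r (s≤s⁻¹ (≰⇒> k<2+i))
    bound (yes 2+i≤k) with j , refl ← m≤n⇒∃[o]m+o≡n 2+i≤k = begin
      ∑[ r ∈ allSeqs (2 + i + j) n ] lowRepeatCount D (drop i r)
        ≡⟨ cong (λ k → ∑[ r ∈ allSeqs k n ] lowRepeatCount D (drop i r)) (+-comm-middle i j) ⟩
      ∑[ r ∈ allSeqs (i + (2 + j)) n ] lowRepeatCount D (drop i r)
        ≡⟨ ∑-allSeqs-drop i (2 + j) (lowRepeatCount D) ⟩
      n ^ i * ∑ (allSeqs (2 + j) n) (lowRepeatCount D)
        ≤⟨ *-monoʳ-≤ (n ^ i) (∑-allSeqs-lowRepeatCount≤ D j) ⟩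
      n ^ i * (n * n ^ j * (n * D))
        ≡⟨ solve 4 (λ a b m d → a :* (m :* b :* (m :* d)) := d :* (m :* (m :* (a :* b)))) refl (n ^ i) (n ^ j) n D ⟩
      D * (n * (n * (n ^ i * n ^ j)))
        ≡⟨ cong (λ e → D * (n * (n * e))) (^-distribˡ-+-* n i j) ⟨
      D * n ^ (2 + i + j) ∎
      where
      +-comm-middle : ∀ i j → 2 + i + j ≡ i + (2 + j)
      +-comm-middle = solve 2 (λ i j → con 2 :+ i :+ j := i :+ (con 2 :+ j)) refl

-- Counting non-rainbow cycles

absorb-half : ∀ {N R a b} s → N ≤ s * (a + b) → 2 * s * b ≤ N + R → N ≤ 2 * s * a + R
absorb-half {N} {R} {a} {b} s N≤ 2sb≤ = +-cancelʳ-≤ N N (2 * s * a + R) (begin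
  N + N                  ≡⟨ solve 1 (λ N → N :+ N := con 2 :* N) refl N ⟩
  2 * N                  ≤⟨ *-monoʳ-≤ 2 N≤ ⟩
  2 * (s * (a + b))      ≡⟨ solve 3 (λ s a b → con 2 :* (s :* (a :+ b)) := con 2 :* s :* a :+ con 2 :* s :* b) refl s a b ⟩
  2 * s * a + 2 * s * b  ≤⟨ +-monoʳ-≤ (2 * s * a) 2sb≤ ⟩
  2 * s * a + (N + R)    ≡⟨ solve 3 (λ x N R → x :+ (N :+ R) := x :+ R :+ N) refl (2 * s * a) N R ⟩
  2 * s * a + R + N      ∎)
  where open ≤-Reasoning

threshold : ℕ → ℕ
threshold k = 2 * (3 + k) * k + (2 + k)

cycleBound : ℕ → ℕ
cycleBound k = 2 * (3 + k) * ((1 + k) * threshold k)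

module _ {n : ℕ} {G : Graph n} (c : ProperEdgeColouring G) (k : ℕ) where

  private
    m = 3 + k
    D = threshold k
    cycle = isLabelledCycle G
    repeats = repeatsFirstColour c
    low = lowCodegree c D

    nonRainbowCycle rainbowCycle lowRepeat highRepeat : List (Fin n) → Bool
    nonRainbowCycle xs = not (isRainbow c xs) ∧ cycle xs
    rainbowCycle    xs = isRainbow c xs ∧ cycle xs
    lowRepeat       xs = low xs ∧ repeats xs
    highRepeat      xs = not (low xs) ∧ repeats xs

    count : (List (Fin n) → Bool) → ℕ
    count p = ∑[ xs ∈ allSeqs m n ] 𝟙 (p xs)

    count-split : ∀ (p q : List (Fin n) → Bool) →
                  count q ≡ count (λ xs → p xs ∧ q xs) + count (λ xs → not (p xs) ∧ q xs)
    count-split p q = trans (∑-cong (allSeqs m n) (λ xs → 𝟙-split (p xs) (q xs))) (∑-+ (allSeqs m n) _ _)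

  nonRainbowCycle-count≤repeats : count nonRainbowCycle ≤ m * count repeats
  nonRainbowCycle-count≤repeats = begin
    count nonRainbowCycle
      ≤⟨ ∑-allSeqs-mono m (λ xs ∣xs∣ → 𝟙-≤-∑ (λ a → repeats (rotate a xs)) (rotation xs ∣xs∣)) ⟩
    ∑[ xs ∈ allSeqs m n ] ∑[ a ∈ upTo m ] 𝟙 (repeats (rotate a xs))
      ≡⟨ ∑-allSeqs-rotations m (𝟙 ∘ repeats) ⟩
    m * count repeats ∎
    where
    open ≤-Reasoning
    rotation : ∀ xs → length xs ≡ m → T (nonRainbowCycle xs) → ∃ λ a → a ∈ upTo m × T (repeats (rotate a xs))
    rotation xs ∣xs∣ t with nr , cyc ← Equivalence.to T-∧ t with a , a< , rep ← nonRainbow⇒rotate c xs cyc nr =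
      a , ∈-upTo⁺ (subst (a <_) ∣xs∣ a<) , rep

  lowRepeat-count≤ : count lowRepeat ≤ (1 + k) * (D * n ^ (1 + k))
  lowRepeat-count≤ = begin
    count lowRepeat
      ≤⟨ ∑-allSeqs-mono m (λ xs ∣xs∣ → 𝟙-≤-∑ (λ i → lowRepeatAt c D i xs) (position xs ∣xs∣)) ⟩
    ∑[ xs ∈ allSeqs m n ] ∑[ i ∈ upTo (1 + k) ] 𝟙 (lowRepeatAt c D i xs)
      ≡⟨ ∑-comm (allSeqs m n) (upTo (1 + k)) _ ⟩
    ∑[ i ∈ upTo (1 + k) ] ∑[ xs ∈ allSeqs m n ] 𝟙 (lowRepeatAt c D i xs)
      ≤⟨ ∑-mono (upTo (1 + k)) (λ i → ∑-lowRepeatAt≤ c D i (1 + k)) ⟩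
    ∑[ _ ∈ upTo (1 + k) ] (D * n ^ (1 + k))
      ≡⟨ trans (∑-const (upTo (1 + k)) _) (cong (_* (D * n ^ (1 + k))) (length-upTo (1 + k))) ⟩
    (1 + k) * (D * n ^ (1 + k)) ∎
    where
    open ≤-Reasoning
    position : ∀ xs → length xs ≡ m → T (lowRepeat xs) → ∃ λ i → i ∈ upTo (1 + k) × T (lowRepeatAt c D i xs)
    position (v ∷ x ∷ y ∷ r) ∣xs∣ t with i , i∈ , rep ← lowRepeat⇒lowRepeatAt c v x y r t =
      i , subst (λ l → i ∈ upTo (suc l)) (suc-injective (suc-injective (suc-injective ∣xs∣))) i∈ , rep

  highRepeat-count≤ : 2 * m * count highRepeat ≤ count cycle
  highRepeat-count≤ = begin
    2 * m * count highRepeat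
      ≡⟨ cong (2 * m *_) (by-path _) ⟩
    2 * m * ∑[ r ∈ allSeqs (1 + k) n ] ∑[ x ∈ allFin n ] ∑[ v ∈ allFin n ] 𝟙 (highRepeat (v ∷ x ∷ r))
      ≡⟨ trans (∑-cong (allSeqs (1 + k) n) (λ r → ∑-*ˡ (allFin n) (2 * m) _)) (∑-*ˡ (allSeqs (1 + k) n) (2 * m) _) ⟨
    ∑[ r ∈ allSeqs (1 + k) n ] ∑[ x ∈ allFin n ] (2 * m * ∑[ v ∈ allFin n ] 𝟙 (highRepeat (v ∷ x ∷ r)))
      ≤⟨ ∑-allSeqs-mono (1 + k) (λ r ∣r∣ → ∑-mono (allFin n) (λ x → per-path x r ∣r∣)) ⟩
    ∑[ r ∈ allSeqs (1 + k) n ] ∑[ x ∈ allFin n ] ∑[ v ∈ allFin n ] 𝟙 (cycle (v ∷ x ∷ r))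
      ≡⟨ by-path _ ⟨
    count cycle ∎
    where
    open ≤-Reasoning
    by-path : ∀ f →
      ∑ (allSeqs m n) f ≡ ∑[ r ∈ allSeqs (1 + k) n ] ∑[ x ∈ allFin n ] ∑[ v ∈ allFin n ] f (v ∷ x ∷ r)
    by-path f = trans (∑-allSeqs-suc (2 + k) f) (∑-allSeqs-suc (1 + k) _)
    per-path : ∀ x r → length r ≡ 1 + k →
      2 * m * ∑[ v ∈ allFin n ] 𝟙 (highRepeat (v ∷ x ∷ r)) ≤ ∑[ v ∈ allFin n ] 𝟙 (cycle (v ∷ x ∷ r))
    per-path x (y ∷ r) ∣r∣ =
      ∑-highCodegree≤ c (2 * m) x y r (≤-reflexive (cong (λ l → 2 * m * l + suc (suc l)) (suc-injective ∣r∣)))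

  nonRainbowCycle-count≤ : count nonRainbowCycle ≤ cycleBound k * n ^ (1 + k) + count rainbowCycle
  nonRainbowCycle-count≤ = begin
    count nonRainbowCycle
      ≤⟨ absorb-half {a = count lowRepeat} {b = count highRepeat} m N≤m*[low+high] 2m*high≤N+R ⟩
    2 * m * count lowRepeat + count rainbowCycle
      ≤⟨ +-monoˡ-≤ (count rainbowCycle) (*-monoʳ-≤ (2 * m) lowRepeat-count≤) ⟩
    2 * m * ((1 + k) * (D * n ^ (1 + k))) + count rainbowCycle
      ≡⟨ cong (_+ count rainbowCycle) (*-assoc-middle (2 * m) (1 + k) D (n ^ (1 + k))) ⟩
    cycleBound k * n ^ (1 + k) + count rainbowCycle ∎
    where
    open ≤-Reasoning
    N≤m*[low+high] : count nonRainbowCycle ≤ m * (count lowRepeat + count highRepeat)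
    N≤m*[low+high] = ≤-trans nonRainbowCycle-count≤repeats (*-monoʳ-≤ m (≤-reflexive (count-split low repeats)))
    2m*high≤N+R : 2 * m * count highRepeat ≤ count nonRainbowCycle + count rainbowCycle
    2m*high≤N+R = ≤-trans highRepeat-count≤
      (≤-reflexive (trans (count-split (isRainbow c) cycle) (+-comm (count rainbowCycle) _)))
    *-assoc-middle : ∀ a b d e → a * (b * (d * e)) ≡ a * (b * d) * e
    *-assoc-middle = solve 4 (λ a b d e → a :* (b :* (d :* e)) := a :* (b :* d) :* e) refl

-- The rounding in r / d costs at most d, which d * e pays for when e ≥ 1.
/-affine : ∀ {a r} d .{{_ : NonZero d}} K e → a ≤ K * e + r → a / d ≤ (K + d) * e + (K + d) * (r / d)
/-affine {a} {r} d K zero a≤ = begin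
  a / d                               ≤⟨ /-monoˡ-≤ d (subst (a ≤_) (cong (_+ r) (*-zeroʳ K)) a≤) ⟩
  r / d                               ≤⟨ m≤n*m (r / d) d ⟩
  d * (r / d)                         ≤⟨ *-monoˡ-≤ (r / d) (m≤n+m d K) ⟩
  (K + d) * (r / d)                   ≤⟨ m≤n+m _ ((K + d) * zero) ⟩
  (K + d) * zero + (K + d) * (r / d)  ∎
  where open ≤-Reasoning
/-affine {a} {r} d K (suc e) a≤ = begin
  a / d                                  ≤⟨ m/n≤m a d ⟩
  a                                      ≤⟨ a≤ ⟩
  K * suc e + r                          ≤⟨ +-monoʳ-≤ (K * suc e) r≤ ⟩
  K * suc e + (d + d * (r / d))          ≤⟨ +-monoʳ-≤ (K * suc e) (+-monoˡ-≤ (d * (r / d)) (m≤m*n d (suc e))) ⟩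
  K * suc e + (d * suc e + d * (r / d))  ≡⟨ *-distribʳ-+-+ K (suc e) d (r / d) ⟩
  (K + d) * suc e + d * (r / d)          ≤⟨ +-monoʳ-≤ ((K + d) * suc e) (*-monoˡ-≤ (r / d) (m≤n+m d K)) ⟩
  (K + d) * suc e + (K + d) * (r / d)    ∎
  where
  open ≤-Reasoning
  *-distribʳ-+-+ : ∀ K x d q → K * x + (d * x + d * q) ≡ (K + d) * x + d * q
  *-distribʳ-+-+ = solve 4 (λ K x d q → K :* x :+ (d :* x :+ d :* q) := (K :+ d) :* x :+ d :* q) refl
  r≤ : r ≤ d + d * (r / d)
  r≤ = begin
    r                  ≡⟨ m≡m%n+[m/n]*n r d ⟩
    r % d + r / d * d  ≤⟨ +-mono-≤ (<⇒≤ (m%n<n r d)) (≤-reflexive (*-comm (r / d) d)) ⟩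
    d + d * (r / d)    ∎

copiesBound : ℕ → ℕ
copiesBound k = cycleBound k + 2 * (3 + k)

nonRainbowCopies≤ : ∀ {n} {G : Graph n} (c : ProperEdgeColouring G) k →
  nonRainbowCopiesOf c (3 + k) ≤ copiesBound k * n ^ (1 + k) + copiesBound k * rainbowCopiesOf c (3 + k)
nonRainbowCopies≤ {n} {G} c k = /-affine (2 * (3 + k)) (cycleBound k) (n ^ (1 + k))
  (subst₂ (λ N R → N ≤ cycleBound k * n ^ (1 + k) + R)
    (sym (length-filterᵇ² (isLabelledCycle G) (not ∘ isRainbow c) (allSeqs (3 + k) n)))
    (sym (length-filterᵇ² (isLabelledCycle G) (isRainbow c) (allSeqs (3 + k) n)))
    (nonRainbowCycle-count≤ c k))

-- For l = 2 + _, the terms 3 + (2 * l ∸ 2) and 1 + (2 * l ∸ 2) reduce to suc (2 * l) and 2 * l ∸ 1.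
lemma3p2 : (l : ℕ) → 2 ≤ l →
    ∃ λ (K : ℕ) → (n : ℕ) (G : Graph n) (c : ProperEdgeColouring G) →
      nonRainbowCopiesOf c (suc (2 * l))
        ≤ K * n ^ (2 * l ∸ 1) + K * rainbowCopiesOf c (suc (2 * l))
lemma3p2 (suc zero)       (s≤s ())
lemma3p2 l@(suc (suc _)) _ = copiesBound (2 * l ∸ 2) , λ n G c → nonRainbowCopies≤ c (2 * l ∸ 2)
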